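{- Let $C_r=v_1v_2\cdots v_rv_1$ and let $G=C_r(P_{n_1+1},\ldots,P_{n_r+1})$ be an $n$-vertex unicyclic graph, and suppose $k\neq t$ are indices with $n_k\geqslant 1$ and $n_t\geqslant 1$. \begin{itemize} \item[(i)] If $\sum_{i\neq k,t}(n_i+1)d_G(v_i,v_k)\leqslant\sum_{i\neq k,t}(n_i+1)d_G(v_i,v_t)$, then $W(G)<W(G')$, where $G'$ is obtained from $G$ by replacing $P_{n_k+1}$ at $v_k$ by $P_1$ and $P_{n_t+1}$ at $v_t$ by $P_{n_k+n_t+1}$ (all other attached paths unchanged). \item[(ii)] If $\sum_{i\neq k,t}(n_i+1)d_G(v_i,v_k)>\sum_{i\neq k,t}(n_i+1)d_G(v_i,v_t)$, then $W(G)<W(G'')$, where $G''$ is obtained from $G$ by replacing $P_{n_k+1}$ at $v_k$ by $P_{n_k+n_t+1}$ and $P_{n_t+1}$ at $v_t$ by $P_1$ (all other attached paths unchanged). \end{itemize}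
   Context: $W$ is the Wiener index (sum of distances over all unordered vertex pairs). For $n_1,\dots,n_r\geqslant 0$, $C_r(P_{n_1+1},\dots,P_{n_r+1})$ is obtained from the cycle $C_r=v_1\cdots v_rv_1$ by identifying each $v_i$ with an end-vertex of a path on $n_i+1$ vertices (a path $P_1$ adds nothing); its order is $\sum_i n_i+r$. Sums $\sum_{i\neq k,t}$ range over $i\in\{1,\dots,r\}\setminus\{k,t\}$. -}

module Defs where

open import Data.Nat using (ℕ; zero; suc; _+_; _*_)
open import Data.Bool using (Bool; true; false; _∧_; _∨_; not; if_then_else_)
open import Data.Fin using (Fin; toℕ)
open import Data.Fin.Properties using () renaming (_≟_ to _≟F_)
open import Data.Product using (Σ; _,_; proj₁; proj₂)
open import Data.List using (List; []; _∷_; map; allFin; concatMap; length)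
open import Data.Nat.ListAction using (sum)
open import Data.Bool.ListAction using (any)
open import Relation.Nullary.Decidable using (⌊_⌋)

_=ℕ_ : ℕ → ℕ → Bool
zero  =ℕ zero  = true
zero  =ℕ suc _ = false
suc _ =ℕ zero  = false
suc m =ℕ suc n = m =ℕ n

_=F_ : ∀ {r} → Fin r → Fin r → Bool
i =F j = ⌊ i ≟F j ⌋

-- The graph C_r(P_{n_1+1}, …, P_{n_r+1}).
-- Vertex (i , a) is the vertex at distance a from v_i along the path
-- attached at v_i (a = 0 is the cycle vertex v_i itself; a ≤ n_i).

Vtx : (r : ℕ) → (Fin r → ℕ) → Set
Vtx r n = Σ (Fin r) (λ i → Fin (suc (n i)))

vertices : (r : ℕ) (n : Fin r → ℕ) → List (Vtx r n)
vertices r n = concatMap (λ i → map (λ a → (i , a)) (allFin (suc (n i)))) (allFin r)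

eqV : ∀ {r n} → Vtx r n → Vtx r n → Bool
eqV {r} {n} (i , a) (j , b) = (i =F j) ∧ (toℕ a =ℕ toℕ b)

-- j follows i on the cycle v_1 v_2 ⋯ v_r v_1 (indices 0 … r-1)
next : (r : ℕ) → Fin r → Fin r → Bool
next r i j = (suc (toℕ i) =ℕ toℕ j) ∨ ((suc (toℕ i) =ℕ r) ∧ (toℕ j =ℕ 0))

adj : ∀ {r n} → Vtx r n → Vtx r n → Bool
adj {r} {n} (i , a) (j , b) =
  ((toℕ a =ℕ 0) ∧ (toℕ b =ℕ 0) ∧ (next r i j ∨ next r j i))
  ∨ ((i =F j) ∧ ((suc (toℕ a) =ℕ toℕ b) ∨ (suc (toℕ b) =ℕ toℕ a)))

reach : ∀ {r n} → ℕ → Vtx r n → Vtx r n → Bool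
reach zero    u v = eqV u v
reach {r} {n} (suc k) u v =
  reach k u v ∨ any (λ w → adj u w ∧ reach k w v) (vertices r n)

-- shortest-path distance: least k with a walk of length ≤ k
-- (search bounded by the number of vertices; the graph is connected)
distSearch : ∀ {r n} → ℕ → ℕ → Vtx r n → Vtx r n → ℕ
distSearch k zero     u v = k
distSearch k (suc f)  u v = if reach k u v then k else distSearch (suc k) f u v

dist : ∀ {r n} → Vtx r n → Vtx r n → ℕ
dist {r} {n} u v = distSearch 0 (length (vertices r n)) u v

pairSum : ∀ {A : Set} → (A → A → ℕ) → List A → ℕ
pairSum f []       = 0
pairSum f (x ∷ xs) = sum (map (f x) xs) + pairSum f xs

W : (r : ℕ) (n : Fin r → ℕ) → ℕ
W r n = pairSum (dist {r} {n}) (vertices r n)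

cv : ∀ {r} (n : Fin r → ℕ) → Fin r → Vtx r n
cv n i = (i , Fin.zero)
  where import Data.Fin as Fin

wsum : (r : ℕ) (n : Fin r → ℕ) (k t x : Fin r) → ℕ
wsum r n k t x =
  sum (map (λ i → if not (i =F k) ∧ not (i =F t)
                   then suc (n i) * dist (cv n i) (cv n x) else 0)
           (allFin r))

move : ∀ {r} (n : Fin r → ℕ) (k t : Fin r) → Fin r → ℕ
move n k t i = if i =F k then 0 else (if i =F t then n k + n t else n i)

move'' : ∀ {r} (n : Fin r → ℕ) (k t : Fin r) → Fin r → ℕ
move'' n k t i = if i =F t then 0 else (if i =F k then n k + n t else n i)

module Submission where

-- The Wiener index is computed in closed form and compared.
-- (§1–§2, §5) A vertex (i , a) has depth a on the path at v_i.  The closed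
-- form δ (|a - b| on one path, a + b + d_C(v_i, v_j) otherwise, d_C the
-- distance on C_r) changes by at most one along edges, and every vertex at
-- positive δ has a neighbour one step closer; so δ is the breadth-first
-- distance `dist` of Defs.  (§3–§5) Summing δ over pairs of paths gives
-- 2W(G) = Σ_{i,j} B_{ij} with explicit blocks; splitting off k and t makes
-- 2W(G) a polynomial in n_k, n_t and data of the rest of G.  (§6) Merging
-- leaves that data unchanged and adds 2(n_k n_t (1 + e) + n_k d) with e, d ≥ 0,
-- d being the slack in the hypothesis; part (ii) is part (i) with k, t swapped.

open import Defs
open import Data.Nat
  using (ℕ; zero; suc; _+_; _*_; _∸_; _⊓_; _⊔_; ∣_-_∣; _≤_; _<_; _>_; _≥_; z≤n; s≤s; s≤s⁻¹; _≤?_)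
open import Data.Nat.Properties
open import Data.Nat.Tactic.RingSolver using (solve-∀)
open import Data.Bool using (Bool; true; false; T; not; _∧_; _∨_; if_then_else_)
open import Data.Bool.Properties using (T-∧; T-∨; T-≡; ∧-comm)
open import Data.Fin as Fin using (Fin; toℕ; fromℕ<)
open import Data.Fin.Properties using (toℕ<n; toℕ-fromℕ<; toℕ-injective)
  renaming (_≟_ to _≟ᶠ_; suc-injective to Fin-suc-injective)
open import Data.List using (List; []; _∷_; _++_; map; tabulate; concatMap; length; allFin)
open import Data.List.Properties using (map-++; map-tabulate; map-cong)
open import Data.List.Membership.Propositional using (_∈_; lose)
open import Data.List.Membership.Propositional.Properties using (∈-concatMap⁺; ∈-map⁺; ∈-allFin)
open import Data.List.Relation.Unary.Any using (satisfied)
open import Data.List.Relation.Unary.Any.Properties using (any⁺; any⁻)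
open import Data.Nat.ListAction using (sum)
open import Data.Nat.ListAction.Properties using (sum-++)
open import Data.Product using (Σ; _×_; _,_; proj₁; proj₂)
open import Data.Product.Function.NonDependent.Propositional using (_×-⇔_)
open import Data.Sum as Sum using (_⊎_; inj₁; inj₂)
open import Data.Sum.Function.Propositional using (_⊎-⇔_)
open import Data.Empty using (⊥-elim)
open import Data.Unit using (tt)
open import Function.Bundles using (_⇔_; mk⇔; Equivalence)
open import Function.Properties.Equivalence using () renaming (trans to ⇔-trans)
open import Relation.Nullary using (Dec; yes; no)
open import Relation.Nullary.Decidable using (toWitness; fromWitness; toWitnessFalse; toSum)
open import Algebra.Properties.Semiring.Sum +-*-semiring
  using (sum-syntax; sum-cong-≗; ∑-distrib-+; ∑-comm; *-distribˡ-sum)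
open import Relation.Binary.Definitions using (tri<; tri≈; tri>)
open import Relation.Binary.PropositionalEquality
open import Function using (_∘_)
open Equivalence using (to; from)

LineAdj : ℕ → ℕ → Set
LineAdj a b = suc a ≡ b ⊎ suc b ≡ a

Step : ℕ → ℕ → ℕ → Set
Step r x z = suc x ≡ z ⊎ (suc x ≡ r × z ≡ 0)

CycAdj : ℕ → ℕ → ℕ → Set
CycAdj r x z = Step r x z ⊎ Step r z x

Near : ℕ → ℕ → Set
Near d d' = d ≤ suc d' × d' ≤ suc d

near-sym : ∀ {d d'} → Near d d' → Near d' d
near-sym (d≤ , d'≤) = d'≤ , d≤

near-suc : ∀ d → Near d (suc d)
near-suc d = ≤-trans (n≤1+n d) (n≤1+n (suc d)) , ≤-refl

∣-∣-near-suc : ∀ a b → Near ∣ a - b ∣ ∣ suc a - b ∣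
∣-∣-near-suc zero    zero    = near-suc 0
∣-∣-near-suc zero    (suc b) = near-sym (near-suc b)
∣-∣-near-suc (suc a) zero    = near-suc (suc a)
∣-∣-near-suc (suc a) (suc b) = ∣-∣-near-suc a b

lineAdj⇒near : ∀ {a b} → LineAdj a b → Near a b
lineAdj⇒near (inj₁ refl) = near-suc _
lineAdj⇒near (inj₂ refl) = near-sym (near-suc _)

lineAdj-near : ∀ {a b} c → LineAdj a b → Near ∣ a - c ∣ ∣ b - c ∣
lineAdj-near {a}     c (inj₁ refl) = ∣-∣-near-suc a c
lineAdj-near {b = b} c (inj₂ refl) = near-sym (∣-∣-near-suc b c)

line-step : ∀ a b → a ≢ b →
  Σ ℕ λ c → LineAdj a c × suc ∣ c - b ∣ ≡ ∣ a - b ∣ × c ≤ a ⊔ b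
line-step zero    zero    a≢b = ⊥-elim (a≢b refl)
line-step zero    (suc b) _   = 1 , inj₁ refl , refl , s≤s z≤n
line-step (suc a) zero    _   = a , inj₂ refl , cong suc (∣-∣-identityʳ a) , n≤1+n a
line-step (suc a) (suc b) a≢b with line-step a b (a≢b ∘ cong suc)
... | c , a~c , closer , c≤ = suc c , Sum.map (cong suc) (cong suc) a~c , closer , s≤s c≤

∣-∣-away-below : ∀ {a b} → a < b → ∣ a - b ∣ ≡ suc ∣ suc a - b ∣
∣-∣-away-below {zero}  {suc b} _         = refl
∣-∣-away-below {suc a} {suc b} (s≤s a<b) = ∣-∣-away-below a<b

∣-∣-away-above : ∀ {a b} → b ≤ a → ∣ suc a - b ∣ ≡ suc ∣ a - b ∣
∣-∣-away-above {a}     {zero}  _         = cong suc (sym (∣-∣-identityʳ a))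
∣-∣-away-above {suc a} {suc b} (s≤s b≤a) = ∣-∣-away-above b≤a

∣-∣-< : ∀ {r x y} → x < r → y < r → ∣ x - y ∣ < r
∣-∣-< {x = x} {y} x<r y<r = ≤-<-trans (∣m-n∣≤m⊔n x y) (⊔-lub x<r y<r)

-- arc r d: length of the shorter of the two arcs of an r-cycle between
-- vertices whose indices differ by d ≤ r.
arc : ℕ → ℕ → ℕ
arc r d = d ⊓ (r ∸ d)

∸-near : ∀ r {d d'} → d' ≤ suc d → r ∸ d ≤ suc (r ∸ d')
∸-near r {d} {d'} d'≤ = m≤n+o⇒m∸n≤o r d (begin
  r                 ≤⟨ m≤n+m∸n r d' ⟩
  d' + (r ∸ d')     ≤⟨ +-monoˡ-≤ (r ∸ d') d'≤ ⟩
  suc d + (r ∸ d')  ≡⟨ +-suc d (r ∸ d') ⟨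
  d + suc (r ∸ d')  ∎)
  where open ≤-Reasoning

arc-reflect : ∀ r {d} → d ≤ r → arc r (r ∸ d) ≡ arc r d
arc-reflect r {d} d≤r rewrite m∸[m∸n]≡n d≤r = ⊓-comm (r ∸ d) d

arc-Near : ∀ r {d d'} → Near d d' → Near (arc r d) (arc r d')
arc-Near r {d} {d'} (d≤ , d'≤) = lip d≤ d'≤ , lip d'≤ d≤
  where
  lip : ∀ {d d'} → d ≤ suc d' → d' ≤ suc d → arc r d ≤ suc (arc r d')
  lip {d} {d'} d≤ d'≤ = ⊓-glb (≤-trans (m⊓n≤m d (r ∸ d)) d≤)
                              (≤-trans (m⊓n≤n d (r ∸ d)) (∸-near r d'≤))

arc-inner : ∀ r {e} → suc e ≤ r ∸ suc e → suc (arc r e) ≡ arc r (suc e)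
arc-inner r {e} inner = trans (cong suc (m≤n⇒m⊓n≡m e≤)) (sym (m≤n⇒m⊓n≡m inner))
  where
  e≤ : e ≤ r ∸ e
  e≤ = ≤-trans (n≤1+n e) (≤-trans inner (∸-monoʳ-≤ r (n≤1+n e)))

arc-outer : ∀ r {s} → suc s ≤ r → r ∸ s < s → suc (arc r (suc s)) ≡ arc r s
arc-outer r {s} s<r outer = begin
  suc (arc r (suc s))  ≡⟨ cong suc (m≥n⇒m⊓n≡n outer') ⟩
  suc (r ∸ suc s)      ≡⟨ +-∸-assoc 1 s<r ⟨
  r ∸ s                ≡⟨ m≥n⇒m⊓n≡n (<⇒≤ outer) ⟨
  arc r s              ∎
  where
  open ≡-Reasoning
  outer' : r ∸ suc s ≤ suc s
  outer' = ≤-trans (∸-monoʳ-≤ r (n≤1+n s)) (≤-trans (<⇒≤ outer) (n≤1+n s))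

arc-pos : ∀ r {d} → 0 < d → d < r → 0 < arc r d
arc-pos r 0<d d<r = ⊓-glb 0<d (m<n⇒0<n∸m d<r)

arc-double : ∀ r {d} → d ≤ r → arc r d + arc r d ≤ r
arc-double r {d} d≤r = begin
  arc r d + arc r d  ≤⟨ +-mono-≤ (m⊓n≤m d (r ∸ d)) (m⊓n≤n d (r ∸ d)) ⟩
  d + (r ∸ d)        ≡⟨ m+[n∸m]≡n d≤r ⟩
  r                  ∎
  where open ≤-Reasoning

cycDist : ℕ → ℕ → ℕ → ℕ
cycDist r x y = arc r ∣ x - y ∣

cycDist-sym : ∀ r x y → cycDist r x y ≡ cycDist r y x
cycDist-sym r x y = cong (arc r) (∣-∣-comm x y)

cycDist-self : ∀ r x → cycDist r x x ≡ 0
cycDist-self r x = cong (arc r) (∣n-n∣≡0 x)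

cycDist-pos : ∀ {r x y} → x < r → y < r → x ≢ y → 0 < cycDist r x y
cycDist-pos {r} {x} {y} x<r y<r x≢y = arc-pos r 0<d (∣-∣-< x<r y<r)
  where
  0<d : 0 < ∣ x - y ∣
  0<d = n≢0⇒n>0 (x≢y ∘ ∣m-n∣≡0⇒m≡n)

cycDist-double : ∀ {r x y} → x < r → y < r → cycDist r x y + cycDist r x y ≤ r
cycDist-double {r} x<r y<r = arc-double r (<⇒≤ (∣-∣-< x<r y<r))

lineAdj⇒cycAdj : ∀ {r x z} → LineAdj x z → CycAdj r x z
lineAdj⇒cycAdj (inj₁ x+1≡z) = inj₁ (inj₁ x+1≡z)
lineAdj⇒cycAdj (inj₂ z+1≡x) = inj₂ (inj₁ z+1≡x)

step-near : ∀ {r x z l} → l < r → Step r x z → Near (cycDist r x l) (cycDist r z l)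
step-near {r} {l = l} _ (inj₁ refl) = arc-Near r (lineAdj-near l (inj₁ refl))
step-near {x = x} {l = l} l<r (inj₂ (refl , refl)) = subst (λ d → Near d (arc (suc x) l)) (sym wrap)
                                                   (arc-Near (suc x) (near-sym (near-suc l)))
  where
  -- from the last vertex x, the vertex l lies at distance x ∸ l = (x + 1) ∸ (l + 1)
  wrap : cycDist (suc x) x l ≡ arc (suc x) (suc l)
  wrap = trans (cong (arc (suc x)) (m≤n⇒∣n-m∣≡n∸m (s≤s⁻¹ l<r))) (arc-reflect (suc x) l<r)

cycDist-lipschitz : ∀ {r x z l} → l < r → CycAdj r x z → cycDist r x l ≤ suc (cycDist r z l)
cycDist-lipschitz l<r (inj₁ x→z) = proj₁ (step-near l<r x→z)
cycDist-lipschitz l<r (inj₂ z→x) = proj₂ (step-near l<r z→x)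

step-away : ∀ {r x y} → x < r → y < r → x ≢ y →
  Σ ℕ λ z → z < r × CycAdj r x z × cycDist r z y ≡ arc r (suc ∣ x - y ∣)
step-away {suc m} {x} {y} x<r y<r x≢y with <-cmp x y
... | tri≈ _ x≡y _ = ⊥-elim (x≢y x≡y)
step-away {suc m} {zero} {y} x<r y<r x≢y | tri< _ _ _ =
  m , n<1+n m , inj₂ (inj₂ (refl , refl)) , wrap
  where
  wrap : cycDist (suc m) m y ≡ arc (suc m) (suc y)
  wrap = trans (cong (arc (suc m)) (m≤n⇒∣n-m∣≡n∸m (s≤s⁻¹ y<r))) (arc-reflect (suc m) y<r)
step-away {suc m} {suc x} {y} x<r y<r x≢y | tri< x<y _ _ =
  x , <-trans (n<1+n x) x<r , lineAdj⇒cycAdj (inj₂ refl) ,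
  cong (arc (suc m)) (∣-∣-away-below (<-trans (n<1+n x) x<y))
... | tri> _ _ y<x with m≤n⇒m<n∨m≡n x<r
...   | inj₁ x+1<r = suc x , x+1<r , lineAdj⇒cycAdj (inj₁ refl) ,
                     cong (arc (suc m)) (∣-∣-away-above (<⇒≤ y<x))
...   | inj₂ x+1≡r = 0 , s≤s z≤n , inj₁ (inj₂ (x+1≡r , refl)) , sym wrap
  where
  wrap : arc (suc m) (suc ∣ x - y ∣) ≡ arc (suc m) y
  wrap = begin
    arc (suc m) (suc ∣ x - y ∣)  ≡⟨ cong (arc (suc m) ∘ suc) (m≤n⇒∣n-m∣≡n∸m (<⇒≤ y<x)) ⟩
    arc (suc m) (suc (x ∸ y))    ≡⟨ cong (arc (suc m)) (+-∸-assoc 1 (<⇒≤ y<x)) ⟨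
    arc (suc m) (suc x ∸ y)      ≡⟨ cong (λ v → arc (suc m) (v ∸ y)) x+1≡r ⟩
    arc (suc m) (suc m ∸ y)      ≡⟨ arc-reflect (suc m) (<⇒≤ y<r) ⟩
    arc (suc m) y                ∎
    where open ≡-Reasoning

cycDist-descent : ∀ {r x y} → x < r → y < r → x ≢ y →
  Σ ℕ λ z → z < r × CycAdj r x z × suc (cycDist r z y) ≡ cycDist r x y
cycDist-descent {r} {x} {y} x<r y<r x≢y with ∣ x - y ∣ ≤? r ∸ ∣ x - y ∣
... | yes inner with line-step x y x≢y
...   | c , x~c , closer , c≤ = c , ≤-<-trans c≤ (⊔-lub x<r y<r) , lineAdj⇒cycAdj x~c ,
        subst (λ d → suc (arc r ∣ c - y ∣) ≡ arc r d) closer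
              (arc-inner r (subst (λ d → d ≤ r ∸ d) (sym closer) inner))
cycDist-descent {r} {x} {y} x<r y<r x≢y | no outer with step-away x<r y<r x≢y
... | z , z<r , x~z , away = z , z<r , x~z ,
      trans (cong suc away) (arc-outer r (∣-∣-< x<r y<r) (≰⇒> outer))

=ℕ-reflects : ∀ {m k} → T (m =ℕ k) ⇔ m ≡ k
=ℕ-reflects = mk⇔ sound complete
  where
  sound : ∀ {m k} → T (m =ℕ k) → m ≡ k
  sound {zero}  {zero}  _ = refl
  sound {suc m} {suc k} h = cong suc (sound h)
  complete : ∀ {m k} → m ≡ k → T (m =ℕ k)
  complete {zero}  refl = tt
  complete {suc m} refl = complete {m} refl

=F-reflects : ∀ {r} {i j : Fin r} → T (i =F j) ⇔ i ≡ j
=F-reflects = mk⇔ toWitness fromWitness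

=F-self : ∀ {r} (i : Fin r) → i =F i ≡ true
=F-self i with i ≟ᶠ i
... | yes _   = refl
... | no i≢i  = ⊥-elim (i≢i refl)

=F-distinct : ∀ {r} {i j : Fin r} → i ≢ j → i =F j ≡ false
=F-distinct {i = i} {j} i≢j with i ≟ᶠ j
... | yes i≡j = ⊥-elim (i≢j i≡j)
... | no _    = refl

lineAdj-reflects : ∀ {a b} → T ((suc a =ℕ b) ∨ (suc b =ℕ a)) ⇔ LineAdj a b
lineAdj-reflects = ⇔-trans T-∨ (=ℕ-reflects ⊎-⇔ =ℕ-reflects)

step-reflects : ∀ {r} {i j : Fin r} → T (next r i j) ⇔ Step r (toℕ i) (toℕ j)
step-reflects = ⇔-trans T-∨ (=ℕ-reflects ⊎-⇔ ⇔-trans T-∧ (=ℕ-reflects ×-⇔ =ℕ-reflects))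

cycAdj-reflects : ∀ {r} {i j : Fin r} → T (next r i j ∨ next r j i) ⇔ CycAdj r (toℕ i) (toℕ j)
cycAdj-reflects = ⇔-trans T-∨ (step-reflects ⊎-⇔ step-reflects)

Edge : ∀ {r n} → Vtx r n → Vtx r n → Set
Edge {r} (i , a) (j , b) =
  (toℕ a ≡ 0 × toℕ b ≡ 0 × CycAdj r (toℕ i) (toℕ j)) ⊎ (i ≡ j × LineAdj (toℕ a) (toℕ b))

edge-reflects : ∀ {r n} {u w : Vtx r n} → T (adj u w) ⇔ Edge u w
edge-reflects =
  ⇔-trans T-∨ (⇔-trans T-∧ (=ℕ-reflects ×-⇔ ⇔-trans T-∧ (=ℕ-reflects ×-⇔ cycAdj-reflects))
               ⊎-⇔ ⇔-trans T-∧ (=F-reflects ×-⇔ lineAdj-reflects))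

eqV-reflects : ∀ {r n} {i j : Fin r} {a : Fin (suc (n i))} {b : Fin (suc (n j))} →
  T (eqV {r} {n} (i , a) (j , b)) ⇔ (i ≡ j × toℕ a ≡ toℕ b)
eqV-reflects = ⇔-trans T-∧ (=F-reflects ×-⇔ =ℕ-reflects)

∑-const : ∀ m c → ∑[ i < m ] c ≡ m * c
∑-const zero    c = refl
∑-const (suc m) c = cong (c +_) (∑-const m c)

=F-suc : ∀ {m} (i k : Fin m) → (Fin.suc i =F Fin.suc k) ≡ (i =F k)
=F-suc i k = by-cases (i ≟ᶠ k)
  where
  by-cases : Dec (i ≡ k) → (Fin.suc i =F Fin.suc k) ≡ (i =F k)
  by-cases (yes refl) = trans (=F-self (Fin.suc i)) (sym (=F-self i))
  by-cases (no i≢k)   = trans (=F-distinct (i≢k ∘ Fin-suc-injective)) (sym (=F-distinct i≢k))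

∑-pick : ∀ {m} (k : Fin m) (g : Fin m → ℕ) →
  ∑[ i < m ] g i ≡ g k + ∑[ i < m ] (if i =F k then 0 else g i)
∑-pick {suc m} Fin.zero    g = refl
∑-pick {suc m} (Fin.suc k) g = begin
  g Fin.zero + ∑[ i < m ] g (Fin.suc i)                  ≡⟨ cong (g Fin.zero +_) (∑-pick k (g ∘ Fin.suc)) ⟩
  g Fin.zero + (g (Fin.suc k) + ∑[ i < m ] g₋ₖ i)         ≡⟨ +-assoc (g Fin.zero) _ _ ⟨
  g Fin.zero + g (Fin.suc k) + ∑[ i < m ] g₋ₖ i           ≡⟨ cong (_+ ∑[ i < m ] g₋ₖ i) (+-comm (g Fin.zero) _) ⟩
  g (Fin.suc k) + g Fin.zero + ∑[ i < m ] g₋ₖ i           ≡⟨ +-assoc (g (Fin.suc k)) _ _ ⟩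
  g (Fin.suc k) + (g Fin.zero + ∑[ i < m ] g₋ₖ i)         ≡⟨ cong (λ s → g (Fin.suc k) + (g Fin.zero + s))
                                                          (sum-cong-≗ (λ i → cong (λ b → if b then 0 else g (Fin.suc i))
                                                                                  (sym (=F-suc i k)))) ⟩
  g (Fin.suc k) + ∑[ i < suc m ] (if i =F Fin.suc k then 0 else g i) ∎
  where
  open ≡-Reasoning
  g₋ₖ : Fin m → ℕ
  g₋ₖ i = if i =F k then 0 else g (Fin.suc i)

outside : ∀ {r} → Fin r → Fin r → Fin r → Bool
outside k t i = not (i =F k) ∧ not (i =F t)

outside⇒≢ : ∀ {r} {k t i : Fin r} → T (outside k t i) → i ≢ k × i ≢ t
outside⇒≢ {k = k} {t} {i} h with to (T-∧ {not (i =F k)} {not (i =F t)}) h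
... | ¬i≡k , ¬i≡t = toWitnessFalse {a? = i ≟ᶠ k} ¬i≡k , toWitnessFalse {a? = i ≟ᶠ t} ¬i≡t

restrict : ∀ {r} → Fin r → Fin r → (Fin r → ℕ) → Fin r → ℕ
restrict k t g i = if outside k t i then g i else 0

∑out : ∀ {r} → Fin r → Fin r → (Fin r → ℕ) → ℕ
∑out {r} k t g = ∑[ i < r ] restrict k t g i

∑-split₂ : ∀ {r} {k t : Fin r} (g : Fin r → ℕ) → k ≢ t → ∑[ i < r ] g i ≡ g k + g t + ∑out k t g
∑-split₂ {r} {k} {t} g k≢t = begin
  ∑[ i < r ] g i                          ≡⟨ ∑-pick k g ⟩
  g k + ∑[ i < r ] g₋ₖ i                  ≡⟨ cong (g k +_) (∑-pick t g₋ₖ) ⟩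
  g k + (g₋ₖ t + ∑[ i < r ] g₋ₖₜ i)       ≡⟨ +-assoc (g k) _ _ ⟨
  g k + g₋ₖ t + ∑[ i < r ] g₋ₖₜ i         ≡⟨ cong₂ (λ x y → g k + x + y) g₋ₖt≡gt (sum-cong-≗ masked) ⟩
  g k + g t + ∑out k t g                  ∎
  where
  open ≡-Reasoning
  g₋ₖ g₋ₖₜ : Fin r → ℕ
  g₋ₖ i  = if i =F k then 0 else g i
  g₋ₖₜ i = if i =F t then 0 else g₋ₖ i
  g₋ₖt≡gt : g₋ₖ t ≡ g t
  g₋ₖt≡gt rewrite =F-distinct (k≢t ∘ sym) = refl
  masked : ∀ i → g₋ₖₜ i ≡ restrict k t g i
  masked i with i =F k | i =F t
  ... | true  | true  = refl
  ... | true  | false = refl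
  ... | false | true  = refl
  ... | false | false = refl

∑out-cong : ∀ {r} {k t : Fin r} {f g : Fin r → ℕ} →
  (∀ i → T (outside k t i) → f i ≡ g i) → ∑out k t f ≡ ∑out k t g
∑out-cong {k = k} {t} {f} {g} f≡g = sum-cong-≗ pointwise
  where
  pointwise : ∀ i → restrict k t f i ≡ restrict k t g i
  pointwise i with outside k t i in o
  ... | true  = f≡g i (from T-≡ o)
  ... | false = refl

∑out-+ : ∀ {r} {k t : Fin r} (f g : Fin r → ℕ) → ∑out k t (λ i → f i + g i) ≡ ∑out k t f + ∑out k t g
∑out-+ {r} {k} {t} f g = trans (sum-cong-≗ {r} pointwise) (∑-distrib-+ (restrict k t f) (restrict k t g))
  where
  pointwise : ∀ i → restrict k t (λ i → f i + g i) i ≡ restrict k t f i + restrict k t g i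
  pointwise i with outside k t i
  ... | true  = refl
  ... | false = refl

∑out-* : ∀ {r} {k t : Fin r} c (f : Fin r → ℕ) → ∑out k t (λ i → c * f i) ≡ c * ∑out k t f
∑out-* {r} {k} {t} c f = trans (sum-cong-≗ {r} pointwise) (sym (*-distribˡ-sum c (restrict k t f)))
  where
  pointwise : ∀ i → restrict k t (λ i → c * f i) i ≡ c * restrict k t f i
  pointwise i with outside k t i
  ... | true  = refl
  ... | false = sym (*-zeroʳ c)

∑out-mono : ∀ {r} {k t : Fin r} {f g : Fin r → ℕ} → (∀ i → f i ≤ g i) → ∑out k t f ≤ ∑out k t g
∑out-mono {k = k} {t} f≤g = ∑-mono (λ i → if-mono (outside k t i) (f≤g i))
  where
  ∑-mono : ∀ {m} {f g : Fin m → ℕ} → (∀ i → f i ≤ g i) → ∑[ i < m ] f i ≤ ∑[ i < m ] g i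
  ∑-mono {zero}  _   = z≤n
  ∑-mono {suc m} f≤g = +-mono-≤ (f≤g Fin.zero) (∑-mono (f≤g ∘ Fin.suc))
  if-mono : ∀ b {x y} → x ≤ y → (if b then x else 0) ≤ (if b then y else 0)
  if-mono true  x≤y = x≤y
  if-mono false _   = z≤n

∑out-swap : ∀ {r} (k t : Fin r) (g : Fin r → ℕ) → ∑out k t g ≡ ∑out t k g
∑out-swap {r} k t g = sum-cong-≗ {r} (λ i → cong (λ b → if b then g i else 0) (∧-comm (not (i =F k)) _))

∑out-ones : ∀ {r} {k t : Fin r} → k ≢ t → 2 + ∑out k t (λ _ → 1) ≡ r
∑out-ones {r} k≢t = trans (sym (∑-split₂ (λ _ → 1) k≢t)) (trans (∑-const r 1) (*-identityʳ r))

∑²-split : ∀ {r} {k t : Fin r} (F : Fin r → Fin r → ℕ) → (∀ i j → F i j ≡ F j i) → k ≢ t →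
  ∑[ i < r ] ∑[ j < r ] F i j
  ≡ F k k + F t t + 2 * F k t + 2 * (∑out k t (λ i → F i k) + ∑out k t (λ i → F i t))
    + ∑out k t (λ i → ∑out k t (F i))
∑²-split {r} {k} {t} F F-sym k≢t = begin
  ∑[ i < r ] ∑[ j < r ] F i j
    ≡⟨ sum-cong-≗ {r} (λ i → ∑-split₂ (F i) k≢t) ⟩
  ∑[ i < r ] (F i k + F i t + ∑out k t (F i))
    ≡⟨ ∑-distrib-+ {r} (λ i → F i k + F i t) (λ i → ∑out k t (F i)) ⟩
  ∑[ i < r ] (F i k + F i t) + ∑[ i < r ] ∑out k t (F i)
    ≡⟨ cong (_+ ∑[ i < r ] ∑out k t (F i)) (∑-distrib-+ {r} (λ i → F i k) (λ i → F i t)) ⟩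
  ∑[ i < r ] F i k + ∑[ i < r ] F i t + ∑[ i < r ] ∑out k t (F i)
    ≡⟨ cong₂ _+_ (cong₂ _+_ (∑-split₂ (λ i → F i k) k≢t) (∑-split₂ (λ i → F i t) k≢t))
                 (∑-split₂ (λ i → ∑out k t (F i)) k≢t) ⟩
  (F k k + F t k + Xk) + (F k t + F t t + Xt) + (∑out k t (F k) + ∑out k t (F t) + R)
    ≡⟨ cong₂ (λ x y → (F k k + F t k + Xk) + (F k t + F t t + Xt) + (x + y + R)) (row≡column k) (row≡column t) ⟩
  (F k k + F t k + Xk) + (F k t + F t t + Xt) + (Xk + Xt + R)
    ≡⟨ cong (λ x → (F k k + x + Xk) + (F k t + F t t + Xt) + (Xk + Xt + R)) (F-sym t k) ⟩
  (F k k + F k t + Xk) + (F k t + F t t + Xt) + (Xk + Xt + R)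
    ≡⟨ regroup (F k k) (F t t) (F k t) Xk Xt R ⟩
  F k k + F t t + 2 * F k t + 2 * (Xk + Xt) + R
    ∎
  where
  open ≡-Reasoning
  Xk Xt R : ℕ
  Xk = ∑out k t (λ i → F i k)
  Xt = ∑out k t (λ i → F i t)
  R  = ∑out k t (λ i → ∑out k t (F i))
  row≡column : ∀ p → ∑out k t (F p) ≡ ∑out k t (λ i → F i p)
  row≡column p = ∑out-cong (λ i _ → F-sym p i)
  regroup : ∀ a b c x y z → (a + c + x) + (c + b + y) + (x + y + z) ≡ a + b + 2 * c + 2 * (x + y) + z
  regroup = solve-∀

sum-map-+ : ∀ {A : Set} (f g : A → ℕ) xs → sum (map (λ x → f x + g x) xs) ≡ sum (map f xs) + sum (map g xs)
sum-map-+ f g []       = refl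
sum-map-+ f g (x ∷ xs) = trans (cong (f x + g x +_) (sum-map-+ f g xs)) (interchange (f x) (g x) _ _)
  where
  interchange : ∀ a b c d → a + b + (c + d) ≡ a + c + (b + d)
  interchange = solve-∀

pairSum-double : ∀ {A : Set} (f : A → A → ℕ) → (∀ x y → f x y ≡ f y x) → (∀ x → f x x ≡ 0) →
  ∀ xs → 2 * pairSum f xs ≡ sum (map (λ x → sum (map (f x) xs)) xs)
pairSum-double f f-sym f-diag []       = refl
pairSum-double f f-sym f-diag (x ∷ xs) = begin
  2 * (S + P)
    ≡⟨ double S P ⟩
  S + (S + 2 * P)
    ≡⟨ cong (λ d → S + (S + d)) (pairSum-double f f-sym f-diag xs) ⟩
  S + (S + D)
    ≡⟨ cong₂ (λ z s → z + S + (s + D)) (sym (f-diag x)) (cong sum (map-cong (f-sym x) xs)) ⟩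
  f x x + S + (sum (map (λ y → f y x) xs) + D)
    ≡⟨ cong (f x x + S +_) (sum-map-+ (λ y → f y x) (λ y → sum (map (f y) xs)) xs) ⟨
  sum (map (λ y → sum (map (f y) (x ∷ xs))) (x ∷ xs))
    ∎
  where
  open ≡-Reasoning
  S P D : ℕ
  S = sum (map (f x) xs)
  P = pairSum f xs
  D = sum (map (λ y → sum (map (f y) xs)) xs)
  double : ∀ s p → 2 * (s + p) ≡ s + (s + 2 * p)
  double = solve-∀

sum-tabulate : ∀ {A : Set} {m} (g : A → ℕ) (f : Fin m → A) →
  sum (map g (tabulate f)) ≡ ∑[ i < m ] g (f i)
sum-tabulate {m = zero}  g f = refl
sum-tabulate {m = suc m} g f = cong (g (f Fin.zero) +_) (sum-tabulate g (f ∘ Fin.suc))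

sum-concatMap-tabulate : ∀ {A B : Set} {m} (g : B → ℕ) (h : A → List B) (f : Fin m → A) →
  sum (map g (concatMap h (tabulate f))) ≡ ∑[ i < m ] sum (map g (h (f i)))
sum-concatMap-tabulate {m = zero}  g h f = refl
sum-concatMap-tabulate {B = B} {m = suc m} g h f = begin
  sum (map g (h (f Fin.zero) ++ rest))            ≡⟨ cong sum (map-++ g (h (f Fin.zero)) rest) ⟩
  sum (map g (h (f Fin.zero)) ++ map g rest)      ≡⟨ sum-++ (map g (h (f Fin.zero))) (map g rest) ⟩
  sum (map g (h (f Fin.zero))) + sum (map g rest) ≡⟨ cong (sum (map g (h (f Fin.zero))) +_)
                                                     (sum-concatMap-tabulate g h (f ∘ Fin.suc)) ⟩
  ∑[ i < suc m ] sum (map g (h (f i)))            ∎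
  where
  open ≡-Reasoning
  rest : List B
  rest = concatMap h (tabulate (f ∘ Fin.suc))

sum-vertices : ∀ r n (g : Vtx r n → ℕ) →
  sum (map g (vertices r n)) ≡ ∑[ i < r ] ∑[ a < suc (n i) ] g (i , a)
sum-vertices r n g = trans (sum-concatMap-tabulate g path (λ i → i)) (sum-cong-≗ {r} along-path)
  where
  path : Fin r → List (Vtx r n)
  path i = map (λ a → (i , a)) (allFin (suc (n i)))
  along-path : ∀ i → sum (map g (path i)) ≡ ∑[ a < suc (n i) ] g (i , a)
  along-path i = trans (cong (sum ∘ map g) (map-tabulate (λ a → a) (λ a → (i , a))))
                       (sum-tabulate g (λ a → (i , a)))

length≡sum : ∀ {A : Set} (xs : List A) → length xs ≡ sum (map (λ _ → 1) xs)
length≡sum []       = refl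
length≡sum (_ ∷ xs) = cong suc (length≡sum xs)

#vertices : ∀ r n → length (vertices r n) ≡ ∑[ i < r ] suc (n i)
#vertices r n = begin
  length (vertices r n)                 ≡⟨ length≡sum (vertices r n) ⟩
  sum (map (λ _ → 1) (vertices r n))     ≡⟨ sum-vertices r n (λ _ → 1) ⟩
  ∑[ i < r ] ∑[ a < suc (n i) ] 1        ≡⟨ sum-cong-≗ {r} (λ i → trans (∑-const (suc (n i)) 1) (*-identityʳ _)) ⟩
  ∑[ i < r ] suc (n i)                   ∎
  where open ≡-Reasoning

-- § 4. Closed forms of the distance sums between two paths, and the algebra
-- of twice the Wiener index as a polynomial in the two special path lengths.

-- tri m = 0 + 1 + ⋯ + m is the total depth of the path P_{m+1} hanging at
-- its root; Q m is twice the Wiener index of P_{m+1}.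
tri : ℕ → ℕ
tri m = ∑[ a < suc m ] toℕ a

Q : ℕ → ℕ
Q m = ∑[ a < suc m ] ∑[ b < suc m ] ∣ toℕ a - toℕ b ∣

-- Sum of distances between a path P_{x+1} and a path P_{y+1} whose roots are
-- at cycle distance c, given Tx = tri x and Ty = tri y.
cross : (x y Tx Ty c : ℕ) → ℕ
cross x y Tx Ty c = suc y * Tx + suc x * Ty + suc x * suc y * c

blockFormula : ∀ {r} (n : Fin r → ℕ) → Fin r → Fin r → ℕ
blockFormula {r} n i j =
  if i =F j then Q (n i) else cross (n i) (n j) (tri (n i)) (tri (n j)) (cycDist r (toℕ i) (toℕ j))

blockFormula-same : ∀ {r} (n : Fin r → ℕ) i → blockFormula n i i ≡ Q (n i)
blockFormula-same n i rewrite =F-self i = refl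

blockFormula-diff : ∀ {r} (n : Fin r → ℕ) {i j} → i ≢ j →
  blockFormula n i j ≡ cross (n i) (n j) (tri (n i)) (tri (n j)) (cycDist r (toℕ i) (toℕ j))
blockFormula-diff n i≢j rewrite =F-distinct i≢j = refl

blockFormula-sym : ∀ {r} (n : Fin r → ℕ) i j → blockFormula n i j ≡ blockFormula n j i
blockFormula-sym {r} n i j with toSum (i ≟ᶠ j)
... | inj₁ refl = refl
... | inj₂ i≢j rewrite =F-distinct i≢j | =F-distinct (i≢j ∘ sym) | cycDist-sym r (toℕ i) (toℕ j) =
  cross-sym (n i) (n j) (tri (n i)) (tri (n j)) _
  where
  cross-sym : ∀ x y Tx Ty c → suc y * Tx + suc x * Ty + suc x * suc y * c
                              ≡ suc x * Ty + suc y * Tx + suc y * suc x * c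
  cross-sym = solve-∀

blockFormula-cong : ∀ {r} {n n' : Fin r → ℕ} i j → n' i ≡ n i → n' j ≡ n j →
  blockFormula n' i j ≡ blockFormula n i j
blockFormula-cong {r} i j = cong₂ (λ x y → if i =F j then Q x else cross x y (tri x) (tri y) (cycDist r (toℕ i) (toℕ j)))

∑-depth : ∀ m x p → ∑[ a < suc m ] (x + p * toℕ a) ≡ suc m * x + p * tri m
∑-depth m x p = trans (∑-distrib-+ {suc m} (λ _ → x) (λ a → p * toℕ a))
                      (cong₂ _+_ (∑-const (suc m) x) (sym (*-distribˡ-sum {suc m} p toℕ)))

tri-suc : ∀ m → tri (suc m) ≡ suc m + tri m
tri-suc m = trans (∑-distrib-+ {suc m} (λ _ → 1) toℕ) (cong (_+ tri m) (trans (∑-const (suc m) 1) (*-identityʳ (suc m))))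

Q-suc : ∀ m → Q (suc m) ≡ tri (suc m) + (tri (suc m) + Q m)
Q-suc m = cong (tri (suc m) +_) (∑-distrib-+ {suc m} (λ a → suc (toℕ a)) (λ a → ∑[ b < suc m ] ∣ toℕ a - toℕ b ∣))

-- Joining two paths at their roots.
tri-+ : ∀ a b → tri (a + b) ≡ tri a + tri b + a * b
tri-+ zero    b = sym (+-identityʳ (tri b))
tri-+ (suc a) b = begin
  tri (suc (a + b))                 ≡⟨ tri-suc (a + b) ⟩
  suc (a + b) + tri (a + b)         ≡⟨ cong (suc (a + b) +_) (tri-+ a b) ⟩
  suc (a + b) + (tri a + tri b + a * b) ≡⟨ regroup a b (tri a) (tri b) ⟩
  suc a + tri a + tri b + suc a * b ≡⟨ cong (λ x → x + tri b + suc a * b) (tri-suc a) ⟨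
  tri (suc a) + tri b + suc a * b   ∎
  where
  open ≡-Reasoning
  regroup : ∀ a b Ta Tb → suc (a + b) + (Ta + Tb + a * b) ≡ suc a + Ta + Tb + suc a * b
  regroup = solve-∀

Q-+ : ∀ a b → Q (a + b) ≡ Q a + Q b + 2 * (a * tri b + b * tri a)
Q-+ zero    b = regroup (Q b) b
  where
  regroup : ∀ Qb b → Qb ≡ 0 + Qb + 2 * (0 * tri b + b * 0)
  regroup Qb b = trans (sym (+-identityʳ Qb)) (cong (Qb +_) (cong (2 *_) (sym (*-zeroʳ b))))
Q-+ (suc a) b = begin
  Q (suc a + b)
    ≡⟨ Q-suc (a + b) ⟩
  tri (suc a + b) + (tri (suc a + b) + Q (a + b))
    ≡⟨ cong₂ (λ x q → x + (x + q)) (tri-+ (suc a) b) (Q-+ a b) ⟩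
  (tri (suc a) + Tb + suc a * b) + ((tri (suc a) + Tb + suc a * b) + (Qa + Qb + 2 * (a * Tb + b * Ta)))
    ≡⟨ cong (λ s → (s + Tb + suc a * b) + ((s + Tb + suc a * b) + (Qa + Qb + 2 * (a * Tb + b * Ta)))) (tri-suc a) ⟩
  (suc a + Ta + Tb + suc a * b) + ((suc a + Ta + Tb + suc a * b) + (Qa + Qb + 2 * (a * Tb + b * Ta)))
    ≡⟨ regroup a b Ta Tb Qa Qb ⟩
  (suc a + Ta) + ((suc a + Ta) + Qa) + Qb + 2 * (suc a * Tb + b * (suc a + Ta))
    ≡⟨ cong (λ s → s + (s + Qa) + Qb + 2 * (suc a * Tb + b * s)) (tri-suc a) ⟨
  tri (suc a) + (tri (suc a) + Qa) + Qb + 2 * (suc a * Tb + b * tri (suc a))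
    ≡⟨ cong (λ q → q + Qb + 2 * (suc a * Tb + b * tri (suc a))) (Q-suc a) ⟨
  Q (suc a) + Qb + 2 * (suc a * Tb + b * tri (suc a))
    ∎
  where
  open ≡-Reasoning
  Ta Tb Qa Qb : ℕ
  Ta = tri a
  Tb = tri b
  Qa = Q a
  Qb = Q b
  regroup : ∀ a b Ta Tb Qa Qb →
    (suc a + Ta + Tb + suc a * b) + ((suc a + Ta + Tb + suc a * b) + (Qa + Qb + 2 * (a * Tb + b * Ta)))
    ≡ (suc a + Ta) + ((suc a + Ta) + Qa) + Qb + 2 * (suc a * Tb + b * (suc a + Ta))
  regroup = solve-∀

-- The data of the rest of the graph, as seen from the paths at v_k and v_t
-- (Σ' ranges over i ∉ {k, t}): c = d(v_k, v_t), A = Σ' tri n_i,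
-- N = Σ' (n_i + 1), Sk and St the weighted distances Σ' (n_i + 1) d(v_i, v_p)
-- for p = k, t, and R the part of the distance sum inside the rest.
record Rest : Set where
  constructor rest
  field c A N Sk St R : ℕ

rest-cong : ∀ {c A A' N N' Sk Sk' St St' R R'} → A ≡ A' → N ≡ N' → Sk ≡ Sk' → St ≡ St' → R ≡ R' →
  rest c A N Sk St R ≡ rest c A' N' Sk' St' R'
rest-cong refl refl refl refl refl = refl

-- Twice the Wiener index as a polynomial in the lengths a, b of the paths at
-- v_k, v_t, the values Ta, Tb, Qa, Qb standing for tri a, tri b, Q a, Q b,
-- and the rest.
wienerPoly : (a b Ta Tb Qa Qb : ℕ) → Rest → ℕ
wienerPoly a b Ta Tb Qa Qb (rest c A N Sk St R) =
  Qa + Qb + 2 * cross a b Ta Tb c + 2 * (column a Ta Sk + column b Tb St) + R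
  where
  -- distances between the path P_{x+1} at v_p and the rest
  column : ℕ → ℕ → ℕ → ℕ
  column x Tx S = suc x * A + Tx * N + suc x * S

wienerForm : ℕ → ℕ → Rest → ℕ
wienerForm a b = wienerPoly a b (tri a) (tri b) (Q a) (Q b)

weighted : ∀ {r} (k t : Fin r) (n : Fin r → ℕ) → Fin r → ℕ
weighted {r} k t n p = ∑out k t (λ i → suc (n i) * cycDist r (toℕ i) (toℕ p))

restOf : ∀ {r} (k t : Fin r) (n : Fin r → ℕ) → Rest
restOf {r} k t n = rest (cycDist r (toℕ k) (toℕ t)) (∑out k t (tri ∘ n)) (∑out k t (suc ∘ n))
                        (weighted k t n k) (weighted k t n t) (∑out k t (λ i → ∑out k t (blockFormula n i)))

restOf-agree : ∀ {r} {k t : Fin r} (n n' : Fin r → ℕ) →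
  (∀ i → T (outside k t i) → n' i ≡ n i) → restOf k t n' ≡ restOf k t n
restOf-agree n n' agree = rest-cong (∑out-cong (λ i o → cong tri (agree i o)))
                                   (∑out-cong (λ i o → cong suc (agree i o)))
                                   (∑out-cong (λ i o → weight (agree i o)))
                                   (∑out-cong (λ i o → weight (agree i o)))
                                   (∑out-cong (λ i oi → ∑out-cong (λ j oj → blockFormula-cong i j (agree i oi) (agree j oj))))
  where
  weight : ∀ {x y d} → x ≡ y → suc x * d ≡ suc y * d
  weight = cong (λ z → suc z * _)

∑out-column : ∀ {r} {k t p : Fin r} (n : Fin r → ℕ) → (∀ i → T (outside k t i) → i ≢ p) →
  ∑out k t (λ i → blockFormula n i p)
  ≡ suc (n p) * ∑out k t (tri ∘ n) + tri (n p) * ∑out k t (suc ∘ n) + suc (n p) * weighted k t n p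
∑out-column {r} {k} {t} {p} n i≢p = begin
  ∑out k t (λ i → blockFormula n i p)
    ≡⟨ ∑out-cong (λ i o → trans (blockFormula-diff n (i≢p i o)) (expand (n i) (n p) (tri (n i)) (tri (n p)) (cd i))) ⟩
  ∑out k t (λ i → suc (n p) * tri (n i) + tri (n p) * suc (n i) + suc (n p) * (suc (n i) * cd i))
    ≡⟨ ∑out-+ (λ i → suc (n p) * tri (n i) + tri (n p) * suc (n i)) (λ i → suc (n p) * (suc (n i) * cd i)) ⟩
  ∑out k t (λ i → suc (n p) * tri (n i) + tri (n p) * suc (n i)) + ∑out k t (λ i → suc (n p) * (suc (n i) * cd i))
    ≡⟨ cong₂ _+_ (trans (∑out-+ (λ i → suc (n p) * tri (n i)) (λ i → tri (n p) * suc (n i)))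
                        (cong₂ _+_ (∑out-* (suc (n p)) (tri ∘ n)) (∑out-* (tri (n p)) (suc ∘ n))))
                 (∑out-* (suc (n p)) (λ i → suc (n i) * cd i)) ⟩
  suc (n p) * ∑out k t (tri ∘ n) + tri (n p) * ∑out k t (suc ∘ n) + suc (n p) * weighted k t n p
    ∎
  where
  open ≡-Reasoning
  cd : Fin r → ℕ
  cd i = cycDist r (toℕ i) (toℕ p)
  expand : ∀ x y Tx Ty c → suc y * Tx + suc x * Ty + suc x * suc y * c
                           ≡ suc y * Tx + Ty * suc x + suc y * (suc x * c)
  expand = solve-∀

∑blockFormula≡wienerForm : ∀ {r} {k t : Fin r} (n : Fin r → ℕ) → k ≢ t →
  ∑[ i < r ] ∑[ j < r ] blockFormula n i j ≡ wienerForm (n k) (n t) (restOf k t n)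
∑blockFormula≡wienerForm {r} {k} {t} n k≢t =
  trans (∑²-split (blockFormula n) (blockFormula-sym n) k≢t)
        (cong (_+ ∑out k t (λ i → ∑out k t (blockFormula n i)))
              (cong₂ _+_ (cong₂ _+_ (cong₂ _+_ (blockFormula-same n k) (blockFormula-same n t))
                                    (cong (2 *_) (blockFormula-diff n k≢t)))
                         (cong (2 *_) (cong₂ _+_ (∑out-column n (λ i → proj₁ ∘ outside⇒≢))
                                            (∑out-column n (λ i → proj₂ ∘ outside⇒≢))))))

-- The identity behind merge-gain with wienerPoly unfolded, as the ring solver
-- does not unfold definitions: on the left the merged paths (0, a + b), with
-- tri (a + b) and Q (a + b) expanded by tri-+ and Q-+.
merge-polynomial : ∀ a b Ta Tb Qa Qb c A e Sk d R →
  0 + (Qa + Qb + 2 * (a * Tb + b * Ta))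
  + 2 * (suc (a + b) * 0 + suc 0 * (Ta + Tb + a * b) + suc 0 * suc (a + b) * c)
  + 2 * ((suc 0 * A + 0 * (c + e) + suc 0 * Sk)
         + (suc (a + b) * A + (Ta + Tb + a * b) * (c + e) + suc (a + b) * (Sk + d)))
  + R
  ≡ Qa + Qb + 2 * (suc b * Ta + suc a * Tb + suc a * suc b * c)
    + 2 * ((suc a * A + Ta * (c + e) + suc a * Sk) + (suc b * A + Tb * (c + e) + suc b * (Sk + d)))
    + R
    + 2 * (a * b * (1 + e) + a * d)
merge-polynomial = solve-∀

merge-gain : ∀ a b (ρ : Rest) e d → Rest.N ρ ≡ Rest.c ρ + e → Rest.St ρ ≡ Rest.Sk ρ + d →
  wienerForm 0 (a + b) ρ ≡ wienerForm a b ρ + 2 * (a * b * (1 + e) + a * d)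
merge-gain a b ρ@(rest c A _ Sk _ R) e d refl refl = begin
  wienerPoly 0 (a + b) 0 (tri (a + b)) 0 (Q (a + b)) ρ
    ≡⟨ cong₂ (λ Tab Qab → wienerPoly 0 (a + b) 0 Tab 0 Qab ρ) (tri-+ a b) (Q-+ a b) ⟩
  wienerPoly 0 (a + b) 0 (tri a + tri b + a * b) 0 (Q a + Q b + 2 * (a * tri b + b * tri a)) ρ
    ≡⟨ merge-polynomial a b (tri a) (tri b) (Q a) (Q b) c A e Sk d R ⟩
  wienerForm a b ρ + 2 * (a * b * (1 + e) + a * d)
    ∎
  where open ≡-Reasoning

-- § 5. The distance of C_r(P_{n_1+1}, …, P_{n_r+1}) is the closed form δ, and
-- twice the Wiener index is the sum of the block formulas.

module _ {r : ℕ} {n : Fin r → ℕ} where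

  -- Within a path the distance is the difference of depths; otherwise one
  -- climbs to the cycle, walks along the shorter arc and descends again.
  δ : Vtx r n → Vtx r n → ℕ
  δ (i , a) (j , b) = if i =F j then ∣ toℕ a - toℕ b ∣ else toℕ a + toℕ b + cycDist r (toℕ i) (toℕ j)

  δ-same : ∀ i (a b : Fin (suc (n i))) → δ (i , a) (i , b) ≡ ∣ toℕ a - toℕ b ∣
  δ-same i a b rewrite =F-self i = refl

  δ-diff : ∀ {i j} (a : Fin (suc (n i))) (b : Fin (suc (n j))) → i ≢ j →
    δ (i , a) (j , b) ≡ toℕ a + toℕ b + cycDist r (toℕ i) (toℕ j)
  δ-diff a b i≢j rewrite =F-distinct i≢j = refl

  δ-root : ∀ {i j} (a : Fin (suc (n i))) (b : Fin (suc (n j))) → toℕ a ≡ 0 →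
    δ (i , a) (j , b) ≡ toℕ b + cycDist r (toℕ i) (toℕ j)
  δ-root {i} {j} a b a≡0 with toSum (i ≟ᶠ j)
  ... | inj₁ refl = begin
    δ (i , a) (i , b)                    ≡⟨ δ-same i a b ⟩
    ∣ toℕ a - toℕ b ∣                    ≡⟨ cong (λ x → ∣ x - toℕ b ∣) a≡0 ⟩
    toℕ b                                ≡⟨ +-identityʳ (toℕ b) ⟨
    toℕ b + 0                            ≡⟨ cong (toℕ b +_) (cycDist-self r (toℕ i)) ⟨
    toℕ b + cycDist r (toℕ i) (toℕ i)    ∎
    where open ≡-Reasoning
  ... | inj₂ i≢j = trans (δ-diff a b i≢j) (cong (λ x → x + toℕ b + cycDist r (toℕ i) (toℕ j)) a≡0)

  δ-sym : ∀ u v → δ u v ≡ δ v u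
  δ-sym (i , a) (j , b) with toSum (i ≟ᶠ j)
  ... | inj₁ refl = trans (δ-same i a b) (trans (∣-∣-comm (toℕ a) (toℕ b)) (sym (δ-same i b a)))
  ... | inj₂ i≢j   = trans (δ-diff a b i≢j)
                   (trans (cong₂ _+_ (+-comm (toℕ a) (toℕ b)) (cycDist-sym r (toℕ i) (toℕ j)))
                          (sym (δ-diff b a (i≢j ∘ sym))))

  δ-self : ∀ u → δ u u ≡ 0
  δ-self (i , a) = trans (δ-same i a a) (∣n-n∣≡0 (toℕ a))

  δ-lipschitz : ∀ u w v → Edge u w → δ u v ≤ suc (δ w v)
  δ-lipschitz (i , a) (j , b) (l , c) (inj₁ (a≡0 , b≡0 , i~j)) = begin
    δ (i , a) (l , c)                            ≡⟨ δ-root a c a≡0 ⟩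
    toℕ c + cycDist r (toℕ i) (toℕ l)            ≤⟨ +-monoʳ-≤ (toℕ c) (cycDist-lipschitz (toℕ<n l) i~j) ⟩
    toℕ c + suc (cycDist r (toℕ j) (toℕ l))      ≡⟨ +-suc (toℕ c) _ ⟩
    suc (toℕ c + cycDist r (toℕ j) (toℕ l))      ≡⟨ cong suc (δ-root b c b≡0) ⟨
    suc (δ (j , b) (l , c))                      ∎
    where open ≤-Reasoning
  δ-lipschitz (i , a) (_ , b) (l , c) (inj₂ (refl , a~b)) with toSum (i ≟ᶠ l)
  ... | inj₁ refl rewrite δ-same i a c | δ-same i b c = proj₁ (lineAdj-near (toℕ c) a~b)
  ... | inj₂ i≢l   rewrite δ-diff a c i≢l | δ-diff b c i≢l =
    +-monoˡ-≤ (cycDist r (toℕ i) (toℕ l)) (+-monoˡ-≤ (toℕ c) (proj₁ (lineAdj⇒near a~b)))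

  Closer : Vtx r n → Vtx r n → Set
  Closer u v = Σ (Vtx r n) λ w → Edge u w × suc (δ w v) ≡ δ u v

  closer-along-path : ∀ i (a c : Fin (suc (n i))) → toℕ a ≢ toℕ c → Closer (i , a) (i , c)
  closer-along-path i a c a≢c with line-step (toℕ a) (toℕ c) a≢c
  ... | x , a~x , closer , x≤ = (i , fromℕ< x<) , inj₂ (refl , a~w) , shorter
    where
    x< : x < suc (n i)
    x< = ≤-<-trans x≤ (⊔-lub (toℕ<n a) (toℕ<n c))
    a~w : LineAdj (toℕ a) (toℕ (fromℕ< x<))
    a~w = subst (LineAdj (toℕ a)) (sym (toℕ-fromℕ< x<)) a~x
    shorter : suc (δ (i , fromℕ< x<) (i , c)) ≡ δ (i , a) (i , c)
    shorter = begin
      suc (δ (i , fromℕ< x<) (i , c))   ≡⟨ cong suc (δ-same i (fromℕ< x<) c) ⟩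
      suc ∣ toℕ (fromℕ< x<) - toℕ c ∣   ≡⟨ cong (λ y → suc ∣ y - toℕ c ∣) (toℕ-fromℕ< x<) ⟩
      suc ∣ x - toℕ c ∣                 ≡⟨ closer ⟩
      ∣ toℕ a - toℕ c ∣                 ≡⟨ δ-same i a c ⟨
      δ (i , a) (i , c)                 ∎
      where open ≡-Reasoning

  closer-up : ∀ {i l} (a : Fin (suc (n i))) (c : Fin (suc (n l))) {x} → i ≢ l → toℕ a ≡ suc x →
    Closer (i , a) (l , c)
  closer-up {i} {l} a c {x} i≢l a≡ = (i , fromℕ< x<) , inj₂ (refl , inj₂ up) , shorter
    where
    x< : x < suc (n i)
    x< = <-trans (n<1+n x) (subst (_< suc (n i)) a≡ (toℕ<n a))
    up : suc (toℕ (fromℕ< x<)) ≡ toℕ a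
    up = trans (cong suc (toℕ-fromℕ< x<)) (sym a≡)
    shorter : suc (δ (i , fromℕ< x<) (l , c)) ≡ δ (i , a) (l , c)
    shorter = begin
      suc (δ (i , fromℕ< x<) (l , c))
        ≡⟨ cong suc (δ-diff (fromℕ< x<) c i≢l) ⟩
      suc (toℕ (fromℕ< x<) + toℕ c + cycDist r (toℕ i) (toℕ l))
        ≡⟨ cong (λ y → y + toℕ c + cycDist r (toℕ i) (toℕ l)) up ⟩
      toℕ a + toℕ c + cycDist r (toℕ i) (toℕ l)
        ≡⟨ δ-diff a c i≢l ⟨
      δ (i , a) (l , c)
        ∎
      where open ≡-Reasoning

  closer-along-cycle : ∀ {i l} (a : Fin (suc (n i))) (c : Fin (suc (n l))) → i ≢ l → toℕ a ≡ 0 →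
    Closer (i , a) (l , c)
  closer-along-cycle {i} {l} a c i≢l a≡0
    with cycDist-descent (toℕ<n i) (toℕ<n l) (i≢l ∘ toℕ-injective)
  ... | z , z<r , i~z , closer = (fromℕ< z<r , Fin.zero) , inj₁ (a≡0 , refl , i~w) , shorter
    where
    i~w : CycAdj r (toℕ i) (toℕ (fromℕ< z<r))
    i~w = subst (CycAdj r (toℕ i)) (sym (toℕ-fromℕ< z<r)) i~z
    shorter : suc (δ (fromℕ< z<r , Fin.zero) (l , c)) ≡ δ (i , a) (l , c)
    shorter = begin
      suc (δ (fromℕ< z<r , Fin.zero) (l , c))
        ≡⟨ cong suc (δ-root Fin.zero c refl) ⟩
      suc (toℕ c + cycDist r (toℕ (fromℕ< z<r)) (toℕ l))
        ≡⟨ cong (λ y → suc (toℕ c + cycDist r y (toℕ l))) (toℕ-fromℕ< z<r) ⟩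
      suc (toℕ c + cycDist r z (toℕ l))
        ≡⟨ +-suc (toℕ c) _ ⟨
      toℕ c + suc (cycDist r z (toℕ l))
        ≡⟨ cong (toℕ c +_) closer ⟩
      toℕ c + cycDist r (toℕ i) (toℕ l)
        ≡⟨ δ-root a c a≡0 ⟨
      δ (i , a) (l , c)
        ∎
      where open ≡-Reasoning

  closer-neighbour : ∀ u v → 0 < δ u v → Closer u v
  closer-neighbour (i , a) (l , c) 0<δ with toSum (i ≟ᶠ l)
  ... | inj₁ refl = closer-along-path i a c a≢c
    where
    a≢c : toℕ a ≢ toℕ c
    a≢c a≡c = <-irrefl refl (subst (0 <_) (trans (δ-same i a c) (trans (cong (λ y → ∣ y - toℕ c ∣) a≡c)
                                                                  (∣n-n∣≡0 (toℕ c)))) 0<δ)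
  ... | inj₂ i≢l = by-depth (toℕ a) refl
    where
    by-depth : ∀ x → toℕ a ≡ x → Closer (i , a) (l , c)
    by-depth zero    a≡0 = closer-along-cycle a c i≢l a≡0
    by-depth (suc _) a≡  = closer-up a c i≢l a≡

  δ-bound : ∀ u v → δ u v ≤ ∑[ i < r ] suc (n i)
  δ-bound (i , a) (j , b) with toSum (i ≟ᶠ j)
  ... | inj₁ refl = begin
    δ (i , a) (i , b)                        ≡⟨ δ-same i a b ⟩
    ∣ toℕ a - toℕ b ∣                        ≤⟨ ∣m-n∣≤m⊔n (toℕ a) (toℕ b) ⟩
    toℕ a ⊔ toℕ b                            ≤⟨ ⊔-lub (s≤s⁻¹ (toℕ<n a)) (s≤s⁻¹ (toℕ<n b)) ⟩
    n i                                      ≤⟨ m≤n⇒m≤1+n (m≤m+n (n i) _) ⟩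
    suc (n i) + ∑[ l < r ] (if l =F i then 0 else suc (n l)) ≡⟨ ∑-pick i (suc ∘ n) ⟨
    ∑[ l < r ] suc (n l)                     ∎
    where open ≤-Reasoning
  ... | inj₂ i≢j = begin
    δ (i , a) (j , b)
      ≡⟨ δ-diff a b i≢j ⟩
    toℕ a + toℕ b + cycDist r (toℕ i) (toℕ j)
      ≤⟨ +-mono-≤ (+-mono-≤ (s≤s⁻¹ (toℕ<n a)) (s≤s⁻¹ (toℕ<n b))) cd≤ ⟩
    n i + n j + (2 + ∑out i j (λ _ → 1))
      ≤⟨ +-monoʳ-≤ (n i + n j) (+-monoʳ-≤ 2 (∑out-mono {r} (λ _ → s≤s z≤n))) ⟩
    n i + n j + (2 + ∑out i j (suc ∘ n))
      ≡⟨ rearrange (n i) (n j) _ ⟩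
    suc (n i) + suc (n j) + ∑out i j (suc ∘ n)
      ≡⟨ ∑-split₂ (suc ∘ n) i≢j ⟨
    ∑[ l < r ] suc (n l)
      ∎
    where
    open ≤-Reasoning
    cd≤ : cycDist r (toℕ i) (toℕ j) ≤ 2 + ∑out i j (λ _ → 1)
    cd≤ = ≤-trans (m≤m+n _ _) (≤-trans (cycDist-double (toℕ<n i) (toℕ<n j)) (≤-reflexive (sym (∑out-ones i≢j))))
    rearrange : ∀ x y z → x + y + (2 + z) ≡ suc x + suc y + z
    rearrange = solve-∀

  vertex-∈ : ∀ u → u ∈ vertices r n
  vertex-∈ (i , a) = ∈-concatMap⁺ (λ j → map (λ b → (j , b)) (allFin (suc (n j))))
                       (lose (∈-allFin i) (∈-map⁺ (λ b → (i , b)) (∈-allFin a)))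

  reach-sound : ∀ k u v → T (reach k u v) → δ u v ≤ k
  reach-sound zero (i , a) (j , b) h with to (eqV-reflects {r} {n} {i} {j} {a} {b}) h
  ... | refl , a≡b = ≤-reflexive (trans (δ-same i a b) (trans (cong (λ x → ∣ x - toℕ b ∣) a≡b) (∣n-n∣≡0 (toℕ b))))
  reach-sound (suc k) u v h with to T-∨ h
  ... | inj₁ h₀ = m≤n⇒m≤1+n (reach-sound k u v h₀)
  ... | inj₂ h₁ with satisfied (any⁻ _ (vertices r n) h₁)
  ...   | w , u~w∧reach with to T-∧ u~w∧reach
  ...     | u~w , reach-w = ≤-trans (δ-lipschitz u w v (to edge-reflects u~w)) (s≤s (reach-sound k w v reach-w))

  reach-complete : ∀ k u v → δ u v ≤ k → T (reach k u v)
  reach-complete zero (i , a) (j , b) δ≤0 with toSum (i ≟ᶠ j)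
  ... | inj₁ refl = from (eqV-reflects {r} {n} {i} {i} {a} {b})
                          (refl , ∣m-n∣≡0⇒m≡n (n≤0⇒n≡0 (subst (_≤ 0) (δ-same i a b) δ≤0)))
  ... | inj₂ i≢j  = ⊥-elim (<⇒≱ (cycDist-pos (toℕ<n i) (toℕ<n j) (i≢j ∘ toℕ-injective))
                                 (≤-trans (m≤n+m _ (toℕ a + toℕ b)) (subst (_≤ 0) (δ-diff a b i≢j) δ≤0)))
  reach-complete (suc k) u v δ≤ with δ u v ≤? k
  ... | yes δ≤k = from T-∨ (inj₁ (reach-complete k u v δ≤k))
  ... | no δ≰k with closer-neighbour u v (≤-trans (s≤s z≤n) (≰⇒> δ≰k))
  ...   | w , u~w , closer = from T-∨ (inj₂ (any⁺ _ (lose (vertex-∈ w) (from T-∧ (from edge-reflects u~w , reach-w)))))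
    where
    reach-w : T (reach k w v)
    reach-w = reach-complete k w v (s≤s⁻¹ (subst (_≤ suc k) (sym closer) δ≤))

  distSearch≡δ : ∀ k f u v → k ≤ δ u v → δ u v ≤ k + f → distSearch k f u v ≡ δ u v
  distSearch≡δ k zero u v k≤δ δ≤k+0 = ≤-antisym k≤δ (subst (δ u v ≤_) (+-identityʳ k) δ≤k+0)
  distSearch≡δ k (suc f) u v k≤δ δ≤ with reach k u v in found
  ... | true  = ≤-antisym k≤δ (reach-sound k u v (from T-≡ found))
  ... | false = distSearch≡δ (suc k) f u v k<δ (subst (δ u v ≤_) (+-suc k f) δ≤)
    where
    k<δ : k < δ u v
    k<δ with δ u v ≤? k
    ... | yes δ≤k = ⊥-elim (subst T found (reach-complete k u v δ≤k))
    ... | no δ≰k  = ≰⇒> δ≰k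

  dist≡δ : ∀ u v → dist u v ≡ δ u v
  dist≡δ u v = distSearch≡δ 0 (length (vertices r n)) u v z≤n
                 (subst (δ u v ≤_) (sym (#vertices r n)) (δ-bound u v))

  block : Fin r → Fin r → ℕ
  block i j = ∑[ a < suc (n i) ] ∑[ b < suc (n j) ] δ (i , a) (j , b)

  dist-sym : ∀ u v → dist u v ≡ dist v u
  dist-sym u v = trans (dist≡δ u v) (trans (δ-sym u v) (sym (dist≡δ v u)))

  dist-self : ∀ u → dist u u ≡ 0
  dist-self u = trans (dist≡δ u u) (δ-self u)

  twiceW≡blocks : 2 * W r n ≡ ∑[ i < r ] ∑[ j < r ] block i j
  twiceW≡blocks = begin
    2 * pairSum dist V                                    ≡⟨ pairSum-double dist dist-sym dist-self V ⟩
    sum (map (λ u → sum (map (dist u) V)) V)              ≡⟨ sum-vertices r n (λ u → sum (map (dist u) V)) ⟩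
    ∑[ i < r ] ∑[ a < suc (n i) ] sum (map (dist (i , a)) V)
         ≡⟨ sum-cong-≗ {r} (λ i → sum-cong-≗ {suc (n i)} (λ a → sum-vertices r n (dist (i , a)))) ⟩
    ∑[ i < r ] ∑[ a < suc (n i) ] ∑[ j < r ] ∑[ b < suc (n j) ] dist (i , a) (j , b)
         ≡⟨ sum-cong-≗ {r} (λ i → ∑-comm (λ a j → ∑[ b < suc (n j) ] dist (i , a) (j , b))) ⟩
    ∑[ i < r ] ∑[ j < r ] ∑[ a < suc (n i) ] ∑[ b < suc (n j) ] dist (i , a) (j , b)
         ≡⟨ sum-cong-≗ {r} (λ i → sum-cong-≗ {r} (λ j → sum-cong-≗ {suc (n i)} (λ a →
              sum-cong-≗ {suc (n j)} (λ b → dist≡δ (i , a) (j , b))))) ⟩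
    ∑[ i < r ] ∑[ j < r ] block i j                       ∎
    where
    open ≡-Reasoning
    V : List (Vtx r n)
    V = vertices r n

  block≡formula : ∀ i j → block i j ≡ blockFormula n i j
  block≡formula i j with toSum (i ≟ᶠ j)
  ... | inj₁ refl = trans (sum-cong-≗ {suc (n i)} (λ a → sum-cong-≗ {suc (n i)} (λ b → δ-same i a b)))
                          (sym (blockFormula-same n i))
  ... | inj₂ i≢j = begin
    block i j
      ≡⟨ sum-cong-≗ {suc x} (λ a → sum-cong-≗ {suc y} (λ b → trans (δ-diff a b i≢j) (split (toℕ a) (toℕ b) c))) ⟩
    ∑[ a < suc x ] ∑[ b < suc y ] ((toℕ a + c) + 1 * toℕ b)
      ≡⟨ sum-cong-≗ {suc x} (λ a → ∑-depth y (toℕ a + c) 1) ⟩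
    ∑[ a < suc x ] (suc y * (toℕ a + c) + 1 * tri y)
      ≡⟨ sum-cong-≗ {suc x} (λ a → regroup (toℕ a) y c (tri y)) ⟩
    ∑[ a < suc x ] ((suc y * c + tri y) + suc y * toℕ a)
      ≡⟨ ∑-depth x (suc y * c + tri y) (suc y) ⟩
    suc x * (suc y * c + tri y) + suc y * tri x
      ≡⟨ collect x y c (tri x) (tri y) ⟩
    cross x y (tri x) (tri y) c
      ≡⟨ blockFormula-diff n i≢j ⟨
    blockFormula n i j
      ∎
    where
    open ≡-Reasoning
    x y c : ℕ
    x = n i
    y = n j
    c = cycDist r (toℕ i) (toℕ j)
    split : ∀ a b c → a + b + c ≡ (a + c) + 1 * b
    split = solve-∀
    regroup : ∀ a y c Ty → suc y * (a + c) + 1 * Ty ≡ (suc y * c + Ty) + suc y * a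
    regroup = solve-∀
    collect : ∀ x y c Tx Ty → suc x * (suc y * c + Ty) + suc y * Tx ≡ suc y * Tx + suc x * Ty + suc x * suc y * c
    collect = solve-∀

  twiceW≡∑blockFormula : 2 * W r n ≡ ∑[ i < r ] ∑[ j < r ] blockFormula n i j
  twiceW≡∑blockFormula = trans twiceW≡blocks (sum-cong-≗ {r} (λ i → sum-cong-≗ {r} (block≡formula i)))

  wsum≡weighted : ∀ k t p → wsum r n k t p ≡ weighted k t n p
  wsum≡weighted k t p = trans (sum-tabulate (restrict k t (λ i → suc (n i) * dist (cv n i) (cv n p))) (λ i → i))
    (∑out-cong {r} (λ i _ → cong (suc (n i) *_) (trans (dist≡δ (cv n i) (cv n p)) (δ-root {i} {p} Fin.zero Fin.zero refl))))

-- § 6. Merging two pendant paths raises the Wiener index.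

-- c = d(v_k, v_t) ≤ r - 2 ≤ N.
cycDist≤N : ∀ {r} {k t : Fin r} (n : Fin r → ℕ) → r ≥ 3 → k ≢ t →
  cycDist r (toℕ k) (toℕ t) ≤ ∑out k t (suc ∘ n)
cycDist≤N {r} {k} {t} n r≥3 k≢t = ≤-trans (+-cancelˡ-≤ 2 c _ 2+c≤) (∑out-mono {r} (λ _ → s≤s z≤n))
  where
  c : ℕ
  c = cycDist r (toℕ k) (toℕ t)
  2+c≤ : 2 + c ≤ 2 + ∑out k t (λ _ → 1)
  2+c≤ with c ≤? 1
  ... | yes c≤1 = subst (2 + c ≤_) (sym (∑out-ones k≢t)) (≤-trans (+-monoʳ-≤ 2 c≤1) r≥3)
  ... | no  c≰1 = subst (2 + c ≤_) (sym (∑out-ones k≢t))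
                    (≤-trans (≤-reflexive (+-comm 2 c))
                    (≤-trans (+-monoʳ-≤ c (≰⇒> c≰1)) (cycDist-double (toℕ<n k) (toℕ<n t))))

gain-pos : ∀ {a b} e d → a ≥ 1 → b ≥ 1 → 0 < 2 * (a * b * (1 + e) + a * d)
gain-pos {suc a} {suc b} e d _ _ = s≤s z≤n

merge-increases : ∀ {r} (n n' : Fin r → ℕ) {k t : Fin r} → r ≥ 3 → k ≢ t → n k ≥ 1 → n t ≥ 1 →
  weighted k t n k ≤ weighted k t n t →
  n' k ≡ 0 → n' t ≡ n k + n t → (∀ i → i ≢ k → i ≢ t → n' i ≡ n i) →
  W r n < W r n'
merge-increases {r} n n' {k} {t} r≥3 k≢t nk≥1 nt≥1 Sk≤St n'k≡0 n't≡ agree =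
  *-cancelˡ-< 2 (W r n) (W r n') (begin-strict
    2 * W r n
      ≡⟨ trans (twiceW≡∑blockFormula {r} {n}) (∑blockFormula≡wienerForm n k≢t) ⟩
    wienerForm a b ρ
      <⟨ m<m+n _ (gain-pos e d nk≥1 nt≥1) ⟩
    wienerForm a b ρ + gain
      ≡⟨ merge-gain a b ρ e d (sym N≡) (sym St≡) ⟨
    wienerForm 0 (a + b) ρ
      ≡⟨ cong₂ (λ x y → wienerForm x y ρ) n'k≡0 n't≡ ⟨
    wienerForm (n' k) (n' t) ρ
      ≡⟨ cong (wienerForm (n' k) (n' t)) (restOf-agree n n' outside-agree) ⟨
    wienerForm (n' k) (n' t) (restOf k t n')
      ≡⟨ trans (twiceW≡∑blockFormula {r} {n'}) (∑blockFormula≡wienerForm n' k≢t) ⟨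
    2 * W r n'
      ∎)
  where
  open ≤-Reasoning
  a b : ℕ
  a = n k
  b = n t
  ρ : Rest
  ρ = restOf k t n
  e d gain : ℕ
  e = proj₁ (m≤n⇒∃[o]m+o≡n (cycDist≤N n r≥3 k≢t))
  N≡ : Rest.c ρ + e ≡ Rest.N ρ
  N≡ = proj₂ (m≤n⇒∃[o]m+o≡n (cycDist≤N n r≥3 k≢t))
  d = proj₁ (m≤n⇒∃[o]m+o≡n Sk≤St)
  St≡ : Rest.Sk ρ + d ≡ Rest.St ρ
  St≡ = proj₂ (m≤n⇒∃[o]m+o≡n Sk≤St)
  gain = 2 * (a * b * (1 + e) + a * d)
  outside-agree : ∀ i → T (outside k t i) → n' i ≡ n i
  outside-agree i o = agree i (proj₁ (outside⇒≢ o)) (proj₂ (outside⇒≢ o))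

move-emptied : ∀ {r} (n : Fin r → ℕ) k t → move n k t k ≡ 0
move-emptied n k t rewrite =F-self k = refl

move-receiver : ∀ {r} (n : Fin r → ℕ) {k t} → k ≢ t → move n k t t ≡ n k + n t
move-receiver n {k} {t} k≢t rewrite =F-distinct (k≢t ∘ sym) | =F-self t = refl

move-others : ∀ {r} (n : Fin r → ℕ) {k t} i → i ≢ k → i ≢ t → move n k t i ≡ n i
move-others n i i≢k i≢t rewrite =F-distinct i≢k | =F-distinct i≢t = refl

move''-emptied : ∀ {r} (n : Fin r → ℕ) k t → move'' n k t t ≡ 0
move''-emptied n k t rewrite =F-self t = refl

move''-receiver : ∀ {r} (n : Fin r → ℕ) {k t} → k ≢ t → move'' n k t k ≡ n t + n k
move''-receiver n {k} {t} k≢t rewrite =F-distinct k≢t | =F-self k = +-comm (n k) (n t)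

move''-others : ∀ {r} (n : Fin r → ℕ) {k t} i → i ≢ t → i ≢ k → move'' n k t i ≡ n i
move''-others n i i≢t i≢k rewrite =F-distinct i≢t | =F-distinct i≢k = refl

lemma3p13 : (r : ℕ) → r ≥ 3 → (n : Fin r → ℕ) → (k t : Fin r) → k ≢ t
            → n k ≥ 1 → n t ≥ 1
            → (wsum r n k t k ≤ wsum r n k t t → W r n < W r (move n k t))
              × (wsum r n k t k > wsum r n k t t → W r n < W r (move'' n k t))
lemma3p13 r r≥3 n k t k≢t nk≥1 nt≥1 = part-i , part-ii
  where
  part-i : wsum r n k t k ≤ wsum r n k t t → W r n < W r (move n k t)
  part-i Sk≤St = merge-increases n (move n k t) r≥3 k≢t nk≥1 nt≥1
    (subst₂ _≤_ (wsum≡weighted k t k) (wsum≡weighted k t t) Sk≤St)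
    (move-emptied n k t) (move-receiver n k≢t) (move-others n)
  part-ii : wsum r n k t k > wsum r n k t t → W r n < W r (move'' n k t)
  part-ii St<Sk = merge-increases n (move'' n k t) r≥3 (k≢t ∘ sym) nt≥1 nk≥1
    (subst₂ _≤_ (swapped t) (swapped k) (<⇒≤ St<Sk))
    (move''-emptied n k t) (move''-receiver n k≢t) (move''-others n)
    where
    swapped : ∀ p → wsum r n k t p ≡ weighted t k n p
    swapped p = trans (wsum≡weighted k t p) (∑out-swap k t _)
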